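{- Let $\ell>1$ be an integer with $\gcd(\ell,6)=1$, and let $w=\mathsf{A}\mathsf{B}^{\ell-1}$ (one letter $\mathsf A$ followed by $\ell-1$ copies of a distinct letter $\mathsf B$). Then $w$ is $2$-slantable, i.e. $C_2(w)=4C_1(w)$.
   Context: A $d$-dimensional grid of shape $G=\prod_{i=1}^d\mathbb Z/n_i\mathbb Z$ is a map $\Gamma\colon G\to\Sigma$ to an alphabet; its size is $|G|$. For a word $w=w_0\cdots w_{\ell-1}$, an appearance is a pair $(p,\mathbf v)\in G\times(\{ -1,0,1\}^d\setminus\{\mathbf 0\})$ with $\Gamma(p+i\mathbf v)=w_i$ for $0\le i<\ell$. The concentration $c_d(w,\Gamma)$ is the number of appearances divided by $|G|$, and $C_d(w)$ is its supremum over all $d$-dimensional grids. A word is $2$-slantable if $C_2(w)=4C_1(w)$. -}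

module Defs where

open import Data.Nat using (ℕ; zero; suc; _+_; _*_; NonZero)
open import Data.Nat.Properties using (m*n≢0)
open import Data.Nat.DivMod using (_mod_)
open import Data.Fin using (Fin; toℕ)
open import Data.Fin.Base using () renaming (zero to fzero)
open import Data.Vec using (Vec; []; _∷_)
open import Data.List using (List; []; _∷_; map; concatMap; allFin)
open import Data.Nat.ListAction using (sum)
open import Data.Bool using (Bool; true; false; _∧_; if_then_else_)
open import Data.Unit using (⊤; tt)
open import Data.Product using (Σ; _×_; _,_; ∃)
open import Relation.Nullary using (does)
open import Relation.Binary.Definitions using (DecidableEquality)
open import Relation.Binary.PropositionalEquality using (_≡_)
open import Data.Integer using (+_)
open import Data.Rational using (ℚ; _/_; Positive) renaming (_≤_ to _≤ℚ_; _+_ to _+ℚ_; _*_ to _*ℚ_)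

-- A shape of a d-dimensional grid: the vector (n₁ - 1, …, n_d - 1),
-- so that every side length n_i = suc (s_i) is ≥ 1 and |G| ≥ 1.
Shape : ℕ → Set
Shape d = Vec ℕ d

Pos : ∀ {d} → Shape d → Set
Pos []      = ⊤
Pos (n ∷ s) = Fin (suc n) × Pos s

allPos : ∀ {d} (s : Shape d) → List (Pos s)
allPos []      = tt ∷ []
allPos (n ∷ s) = concatMap (λ x → map (λ p → x , p) (allPos s)) (allFin (suc n))

size : ∀ {d} → Shape d → ℕ
size []      = 1
size (n ∷ s) = suc n * size s

size-nonZero : ∀ {d} (s : Shape d) → NonZero (size s)
size-nonZero []      = _
size-nonZero (n ∷ s) = m*n≢0 (suc n) (size s) {{_}} {{size-nonZero s}}

data Step : Set where
  m1 z p1 : Step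

Dir : ℕ → Set
Dir d = Vec Step d

allDirs : ∀ d → List (Dir d)
allDirs zero    = [] ∷ []
allDirs (suc d) = concatMap (λ st → map (st ∷_) (allDirs d)) (m1 ∷ z ∷ p1 ∷ [])

isZeroDir : ∀ {d} → Dir d → Bool
isZeroDir []       = true
isZeroDir (z ∷ v)  = isZeroDir v
isZeroDir (m1 ∷ v) = false
isZeroDir (p1 ∷ v) = false

nonzeroDirs : ∀ d → List (Dir d)
nonzeroDirs d = go (allDirs d)
  where
  go : List (Dir d) → List (Dir d)
  go []       = []
  go (v ∷ vs) = if isZeroDir v then go vs else v ∷ go vs

-- p + i·v in G (coordinates modulo n_j; -1 ≡ n_j - 1 = s_j mod n_j)
shift : ∀ {d} (s : Shape d) → Pos s → Dir d → ℕ → Pos s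
shift []      tt      []        i = tt
shift (n ∷ s) (x , p) (st ∷ v)  i = (off st mod suc n) , shift s p v i
  where
  off : Step → ℕ
  off m1 = toℕ x + i * n
  off z  = toℕ x
  off p1 = toℕ x + i

Grid : (Σ' : Set) → ∀ {d} → Shape d → Set
Grid Σ' s = Pos s → Σ'

module _ {Σ' : Set} (_≟_ : DecidableEquality Σ') where

  appearsAt : ∀ {d} {s : Shape d} → Grid Σ' s → List Σ' → Pos s → Dir d → Bool
  appearsAt {s = s} Γ w p v = go 0 w
    where
    go : ℕ → List Σ' → Bool
    go i []       = true
    go i (a ∷ as) = does (Γ (shift s p v i) ≟ a) ∧ go (suc i) as

  appearances : ∀ {d} {s : Shape d} → Grid Σ' s → List Σ' → ℕ
  appearances {d} {s} Γ w =
    sum (concatMap (λ p → map (λ v → if appearsAt Γ w p v then 1 else 0) (nonzeroDirs d)) (allPos s))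

  concentration : ∀ {d} {s : Shape d} → Grid Σ' s → List Σ' → ℚ
  concentration {s = s} Γ w = _/_ (+ appearances Γ w) (size s) {{size-nonZero s}}

  Concentrations : ℕ → List Σ' → ℚ → Set
  Concentrations d w x = Σ (Shape d) λ s → Σ (Grid Σ' s) λ Γ → concentration Γ w ≡ x

Scale : ℚ → (ℚ → Set) → ℚ → Set
Scale k A x = ∃ λ y → A y × x ≡ k *ℚ y

-- sup A ≤ sup B (for nonempty sets of rationals, sup taken in ℝ ∪ {+∞})
SupLe : (ℚ → Set) → (ℚ → Set) → Set
SupLe A B = ∀ a → A a → ∀ ε → Positive ε → ∃ λ b → B b × a ≤ℚ b +ℚ ε

SupEq : (ℚ → Set) → (ℚ → Set) → Set
SupEq A B = SupLe A B × SupLe B A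

-- C_d(w) as a supremum: we express equalities of such suprema via SupEq.
-- w is 2-slantable : C_2(w) = 4 C_1(w)
TwoSlantable : {Σ' : Set} → DecidableEquality Σ' → List Σ' → Set
TwoSlantable _≟_ w =
  SupEq (Concentrations _≟_ 2 w) (Scale (+ 4 / 1) (Concentrations _≟_ 1 w))

{-# OPTIONS --safe #-}
-- Let ℓ = |w|. Along a fixed direction v, occurrences of w = A Bᴸ cannot start at both q + i·v
-- and q + j·v with i < j < ℓ, since the letter at q + j·v would be both A and B. Translation
-- by i·v permutes the grid, so summing over i < ℓ shows that at most |G|/ℓ occurrences run
-- along v, whence c_d(w, Γ) ≤ (3^d − 1)/ℓ. The bound is attained on (ℤ/ℓ)^d by the grid carrying
-- A exactly where a linear form vanishes mod ℓ, as long as the form changes by a unit mod ℓ along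
-- every direction: x does this for d = 1, and x + 2y, whose steps are ±1, ±2, ±3, for d = 2
-- because gcd(ℓ, 6) = 1. Hence C₁(w) = 2/ℓ and C₂(w) = 8/ℓ = 4 C₁(w).
module Submission where

open import Defs
open import Data.Nat using (ℕ; _<_; _∸_)
open import Data.Nat.GCD using (gcd)
open import Data.List using (List; _∷_; replicate)
open import Relation.Binary.Definitions using (DecidableEquality)
open import Relation.Binary.PropositionalEquality using (_≡_; _≢_)

open import Data.Bool.Base using (Bool; true; false; T; _∧_; if_then_else_)
open import Data.Bool.Properties using (T-∧)
open import Data.Empty using (⊥-elim)
open import Data.Fin.Base using (Fin; toℕ)
open import Data.Fin.Properties using (toℕ-fromℕ<; toℕ-injective; toℕ<n)
import Data.Integer.Base as ℤ
import Data.Integer.Properties as ℤ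
open import Data.List.Base using ([]; map; concatMap; allFin; applyUpTo; upTo; length; tabulate; _∷ʳ_)
open import Data.List.Properties
  using (map-cong; map-∘; map-concatMap; map-upTo; applyUpTo-∷ʳ; length-tabulate; map-tabulate)
open import Data.List.Membership.Propositional using (_∈_)
open import Data.List.Membership.Propositional.Properties using (∈-allFin)
open import Data.List.Relation.Unary.All as All using (All; []; _∷_)
open import Data.List.Relation.Unary.Any using (here; there)
open import Data.Nat.Base using (zero; suc; _+_; _*_; _≤_; z≤n; s≤s; s≤s⁻¹; z<s; s<s; NonZero)
open import Data.Nat.Coprimality using (Coprime; coprime-divisor; gcd≡1⇒coprime)
open import Data.Nat.Divisibility
  using (_∣_; divides; ∣-trans; ∣⇒≤; ∣m+n∣m⇒∣n; ∣n⇒∣m*n; ∣1⇒≡1; m%n≡0⇒n∣m)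
open import Data.Nat.DivMod
  using (_%_; _mod_; m%n%n≡m%n; %-distribˡ-+; %-distribˡ-*; m<n⇒m%n≡m; [m+n]%n≡m%n; m*n%n≡0)
open import Data.Nat.ListAction using (sum)
open import Data.Nat.ListAction.Properties using (sum-++)
open import Data.Nat.Properties
open import Algebra.Properties.CommutativeSemigroup +-commutativeSemigroup using (interchange)
open import Data.Nat.Tactic.RingSolver using (solve-∀)
open import Data.Product using (_×_; _,_; proj₁; proj₂)
open import Data.Rational.Base as ℚ using (ℚ; _/_; Positive)
import Data.Rational.Properties as ℚ
import Data.Rational.Unnormalised.Base as ℚᵘ
import Data.Rational.Unnormalised.Properties as ℚᵘ
open import Data.Unit.Base using (tt)
open import Data.Vec.Base as Vec using (Vec; []; _∷_)
open import Function.Base using (_∘_; const)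
open import Function.Bundles using (_⇔_; mk⇔; Equivalence)
open import Relation.Nullary using (Dec; yes; no; does; ¬_)
open import Relation.Binary.PropositionalEquality
  using (refl; sym; trans; cong; cong₂; subst; subst₂; _≗_; module ≡-Reasoning)

𝟙 : Bool → ℕ
𝟙 b = if b then 1 else 0

T-does : ∀ {P : Set} (P? : Dec P) → T (does P?) ⇔ P
T-does (yes p) = mk⇔ (const p) (const tt)
T-does (no ¬p) = mk⇔ (λ ()) ¬p

module _ {X : Set} where

  sum-map-cong : ∀ {f g : X → ℕ} → f ≗ g → ∀ xs → sum (map f xs) ≡ sum (map g xs)
  sum-map-cong f≗g xs = cong sum (map-cong f≗g xs)

  sum-map-+ : ∀ (f g : X → ℕ) xs → sum (map (λ x → f x + g x) xs) ≡ sum (map f xs) + sum (map g xs)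
  sum-map-+ f g []       = refl
  sum-map-+ f g (x ∷ xs) = trans (cong ((f x + g x) +_) (sum-map-+ f g xs)) (interchange (f x) (g x) _ _)

  sum-map-mono : ∀ {f g : X → ℕ} → (∀ x → f x ≤ g x) → ∀ xs → sum (map f xs) ≤ sum (map g xs)
  sum-map-mono f≤g []       = z≤n
  sum-map-mono f≤g (x ∷ xs) = +-mono-≤ (f≤g x) (sum-map-mono f≤g xs)

  sum-map-const : ∀ c (xs : List X) → sum (map (const c) xs) ≡ length xs * c
  sum-map-const c []       = refl
  sum-map-const c (x ∷ xs) = cong (c +_) (sum-map-const c xs)

  *-sum-map : ∀ k (f : X → ℕ) xs → k * sum (map f xs) ≡ sum (map (λ x → k * f x) xs)
  *-sum-map k f []       = *-zeroʳ k
  *-sum-map k f (x ∷ xs) = trans (*-distribˡ-+ k (f x) _) (cong (k * f x +_) (*-sum-map k f xs))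

  ∈⇒≤-sum-map : ∀ (f : X → ℕ) {x xs} → x ∈ xs → f x ≤ sum (map f xs)
  ∈⇒≤-sum-map f (here refl) = m≤m+n _ _
  ∈⇒≤-sum-map f {xs = y ∷ _} (there x∈xs) = ≤-trans (∈⇒≤-sum-map f x∈xs) (m≤n+m _ (f y))

  sum-map-𝟙-all : ∀ (b : X → Bool) {xs} → All (T ∘ b) xs → sum (map (𝟙 ∘ b) xs) ≡ length xs
  sum-map-𝟙-all b []                = refl
  sum-map-𝟙-all b {x ∷ _} (_ ∷ bxs) with b x
  ... | true = cong suc (sum-map-𝟙-all b bxs)

  sum-concatMap : ∀ (g : X → List ℕ) xs → sum (concatMap g xs) ≡ sum (map (sum ∘ g) xs)
  sum-concatMap g []       = refl
  sum-concatMap g (x ∷ xs) = trans (sum-++ (g x) (concatMap g xs)) (cong (sum (g x) +_) (sum-concatMap g xs))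

sum-map-comm : ∀ {X Y : Set} (h : X → Y → ℕ) xs ys →
  sum (map (λ x → sum (map (h x) ys)) xs) ≡ sum (map (λ y → sum (map (λ x → h x y) xs)) ys)
sum-map-comm h []       ys = sym (trans (sum-map-const 0 ys) (*-zeroʳ (length ys)))
sum-map-comm h (x ∷ xs) ys =
  trans (cong (sum (map (h x) ys) +_) (sum-map-comm h xs ys)) (sym (sum-map-+ (h x) _ ys))

sum-applyUpTo-const : ∀ c n → sum (applyUpTo (const c) n) ≡ n * c
sum-applyUpTo-const c zero    = refl
sum-applyUpTo-const c (suc n) = cong (c +_) (sum-applyUpTo-const c n)

sum-applyUpTo-cong : ∀ {f g : ℕ → ℕ} → f ≗ g → ∀ n → sum (applyUpTo f n) ≡ sum (applyUpTo g n)
sum-applyUpTo-cong f≗g zero    = refl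
sum-applyUpTo-cong f≗g (suc n) = cong₂ _+_ (f≗g 0) (sum-applyUpTo-cong (f≗g ∘ suc) n)

sum-applyUpTo-suc : ∀ (f : ℕ → ℕ) n → sum (applyUpTo f (suc n)) ≡ sum (applyUpTo f n) + f n
sum-applyUpTo-suc f n = begin
  sum (applyUpTo f (suc n))               ≡⟨ cong sum (applyUpTo-∷ʳ f n) ⟨
  sum (applyUpTo f n ∷ʳ f n)               ≡⟨ sum-++ (applyUpTo f n) (f n ∷ []) ⟩
  sum (applyUpTo f n) + (f n + 0)          ≡⟨ cong (sum (applyUpTo f n) +_) (+-identityʳ (f n)) ⟩
  sum (applyUpTo f n) + f n                ∎
  where open ≡-Reasoning

sum-applyUpTo-comm : ∀ {Y : Set} (h : ℕ → Y → ℕ) n ys →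
  sum (applyUpTo (λ i → sum (map (h i) ys)) n) ≡ sum (map (λ y → sum (applyUpTo (λ i → h i y) n)) ys)
sum-applyUpTo-comm h n ys = begin
  sum (applyUpTo (λ i → sum (map (h i) ys)) n)          ≡⟨ cong sum (map-upTo _ n) ⟨
  sum (map (λ i → sum (map (h i) ys)) (upTo n))          ≡⟨ sum-map-comm h (upTo n) ys ⟩
  sum (map (λ y → sum (map (λ i → h i y) (upTo n))) ys)  ≡⟨ sum-map-cong (λ y → cong sum (map-upTo _ n)) ys ⟩
  sum (map (λ y → sum (applyUpTo (λ i → h i y) n)) ys)   ∎
  where open ≡-Reasoning

sum-applyUpTo-rotate : ∀ (g : ℕ → ℕ) n → g n ≡ g 0 → sum (applyUpTo (g ∘ suc) n) ≡ sum (applyUpTo g n)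
sum-applyUpTo-rotate g n gn≡g0 = +-cancelˡ-≡ (g 0) _ _ (begin
  sum (applyUpTo g (suc n))      ≡⟨ sum-applyUpTo-suc g n ⟩
  sum (applyUpTo g n) + g n      ≡⟨ cong (sum (applyUpTo g n) +_) gn≡g0 ⟩
  sum (applyUpTo g n) + g 0      ≡⟨ +-comm _ (g 0) ⟩
  g 0 + sum (applyUpTo g n)      ∎)
  where open ≡-Reasoning

sum-applyUpTo-periodic : ∀ n (f : ℕ → ℕ) → (∀ y → f (y + n) ≡ f y) →
  ∀ c → sum (applyUpTo (λ y → f (y + c)) n) ≡ sum (applyUpTo f n)
sum-applyUpTo-periodic n f periodic zero    = sum-applyUpTo-cong (cong f ∘ +-identityʳ) n
sum-applyUpTo-periodic n f periodic (suc c) = begin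
  sum (applyUpTo (λ y → f (y + suc c)) n)  ≡⟨ sum-applyUpTo-cong (λ y → cong f (+-suc y c)) n ⟩
  sum (applyUpTo (λ y → f (suc y + c)) n)  ≡⟨ sum-applyUpTo-rotate (λ y → f (y + c)) n f[n+c]≡f[c] ⟩
  sum (applyUpTo (λ y → f (y + c)) n)      ≡⟨ sum-applyUpTo-periodic n f periodic c ⟩
  sum (applyUpTo f n)                      ∎
  where
  open ≡-Reasoning
  f[n+c]≡f[c] : f (n + c) ≡ f c
  f[n+c]≡f[c] = trans (cong f (+-comm n c)) (periodic c)

sum-applyUpTo-𝟙≡0 : ∀ n (b : ℕ → Bool) → (∀ {i} → i < n → ¬ T (b i)) → sum (applyUpTo (𝟙 ∘ b) n) ≡ 0
sum-applyUpTo-𝟙≡0 zero    b never = refl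
sum-applyUpTo-𝟙≡0 (suc n) b never with b 0 in b0
... | true  = ⊥-elim (never z<s (subst T (sym b0) tt))
... | false = sum-applyUpTo-𝟙≡0 n (b ∘ suc) (never ∘ s<s)

sum-applyUpTo-𝟙≤1 : ∀ n (b : ℕ → Bool) → (∀ {i j} → i < j → j < n → T (b i) → ¬ T (b j)) →
  sum (applyUpTo (𝟙 ∘ b) n) ≤ 1
sum-applyUpTo-𝟙≤1 zero    b atMostOnce = z≤n
sum-applyUpTo-𝟙≤1 (suc n) b atMostOnce with b 0 in b0
... | true  = ≤-reflexive (cong suc (sum-applyUpTo-𝟙≡0 n (b ∘ suc)
                (λ i<n → atMostOnce z<s (s<s i<n) (subst T (sym b0) tt))))
... | false = sum-applyUpTo-𝟙≤1 n (b ∘ suc) (λ i<j j<n → atMostOnce (s<s i<j) (s<s j<n))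

map-allFin-toℕ : ∀ {Y : Set} n (h : ℕ → Y) → map (h ∘ toℕ) (allFin n) ≡ applyUpTo h n
map-allFin-toℕ n h = trans (map-tabulate (λ x → x) (h ∘ toℕ)) (tabulate-toℕ n h)
  where
  tabulate-toℕ : ∀ {Y : Set} n (h : ℕ → Y) → tabulate {n = n} (h ∘ toℕ) ≡ applyUpTo h n
  tabulate-toℕ zero    h = refl
  tabulate-toℕ (suc n) h = cong (h 0 ∷_) (tabulate-toℕ n (h ∘ suc))

module _ {n : ℕ} .{{_ : NonZero n}} where

  %-+-cong : ∀ a a′ b b′ → a % n ≡ a′ % n → b % n ≡ b′ % n → (a + b) % n ≡ (a′ + b′) % n
  %-+-cong a a′ b b′ a≡a′ b≡b′ = begin
    (a + b) % n                 ≡⟨ %-distribˡ-+ a b n ⟩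
    (a % n + b % n) % n         ≡⟨ cong₂ (λ u v → (u + v) % n) a≡a′ b≡b′ ⟩
    (a′ % n + b′ % n) % n       ≡⟨ %-distribˡ-+ a′ b′ n ⟨
    (a′ + b′) % n               ∎
    where open ≡-Reasoning

  %-*-congˡ : ∀ k a a′ → a % n ≡ a′ % n → (k * a) % n ≡ (k * a′) % n
  %-*-congˡ k a a′ a≡a′ = begin
    (k * a) % n                 ≡⟨ %-distribˡ-* k a n ⟩
    (k % n * (a % n)) % n       ≡⟨ cong (λ u → (k % n * u) % n) a≡a′ ⟩
    (k % n * (a′ % n)) % n      ≡⟨ %-distribˡ-* k a′ n ⟨
    (k * a′) % n                ∎
    where open ≡-Reasoning

module _ (n : ℕ) where

  toℕ-mod : ∀ a → toℕ (a mod suc n) ≡ a % suc n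
  toℕ-mod a = toℕ-fromℕ< _

  mod-cong : ∀ a b → a % suc n ≡ b % suc n → a mod suc n ≡ b mod suc n
  mod-cong a b eq = toℕ-injective (trans (toℕ-mod a) (trans eq (sym (toℕ-mod b))))

  toℕ-mod-id : ∀ (x : Fin (suc n)) → toℕ x mod suc n ≡ x
  toℕ-mod-id x = toℕ-injective (trans (toℕ-mod (toℕ x)) (m<n⇒m%n≡m (toℕ<n x)))

  sum-allFin-rotate : ∀ (g : Fin (suc n) → ℕ) c →
    sum (map (λ x → g ((toℕ x + c) mod suc n)) (allFin (suc n))) ≡ sum (map g (allFin (suc n)))
  sum-allFin-rotate g c = begin
    sum (map (λ x → G (toℕ x + c)) (allFin (suc n)))  ≡⟨ cong sum (map-allFin-toℕ (suc n) (λ y → G (y + c))) ⟩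
    sum (applyUpTo (λ y → G (y + c)) (suc n))         ≡⟨ sum-applyUpTo-periodic (suc n) G G-periodic c ⟩
    sum (applyUpTo G (suc n))                         ≡⟨ cong sum (map-allFin-toℕ (suc n) G) ⟨
    sum (map (G ∘ toℕ) (allFin (suc n)))              ≡⟨ sum-map-cong (cong g ∘ toℕ-mod-id) (allFin (suc n)) ⟩
    sum (map g (allFin (suc n)))                      ∎
    where
    open ≡-Reasoning
    G : ℕ → ℕ
    G y = g (y mod suc n)
    G-periodic : ∀ y → G (y + suc n) ≡ G y
    G-periodic y = cong g (mod-cong (y + suc n) y ([m+n]%n≡m%n y (suc n)))

offset : ℕ → Step → ℕ
offset n m1 = n
offset n z  = 0
offset n p1 = 1

shift-cons : ∀ {d} n (s : Shape d) x p st (v : Dir d) i →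
  shift (n ∷ s) (x , p) (st ∷ v) i ≡ ((toℕ x + i * offset n st) mod suc n , shift s p v i)
shift-cons n s x p m1 v i = refl
shift-cons n s x p z  v i = cong (_, shift s p v i) (mod-cong n (toℕ x) (toℕ x + i * 0) (cong (_% suc n) x≡x+i*0))
  where
  x≡x+i*0 : toℕ x ≡ toℕ x + i * 0
  x≡x+i*0 = sym (trans (cong (toℕ x +_) (*-zeroʳ i)) (+-identityʳ (toℕ x)))
shift-cons n s x p p1 v i = cong (λ t → (toℕ x + t) mod suc n , shift s p v i) (sym (*-identityʳ i))

shift-shift : ∀ {d} (s : Shape d) p v i j → shift s (shift s p v i) v j ≡ shift s p v (i + j)
shift-shift []      tt      []       i j = refl
shift-shift (n ∷ s) (x , p) (st ∷ v) i j = begin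
  shift (n ∷ s) (shift (n ∷ s) (x , p) (st ∷ v) i) (st ∷ v) j
    ≡⟨ cong (λ q → shift (n ∷ s) q (st ∷ v) j) (shift-cons n s x p st v i) ⟩
  shift (n ∷ s) (y , shift s p v i) (st ∷ v) j
    ≡⟨ shift-cons n s y (shift s p v i) st v j ⟩
  ((toℕ y + j * c) mod suc n , shift s (shift s p v i) v j)
    ≡⟨ cong₂ _,_ (mod-cong n (toℕ y + j * c) (toℕ x + (i + j) * c) coordinate) (shift-shift s p v i j) ⟩
  ((toℕ x + (i + j) * c) mod suc n , shift s p v (i + j))
    ≡⟨ shift-cons n s x p st v (i + j) ⟨
  shift (n ∷ s) (x , p) (st ∷ v) (i + j) ∎
  where
  open ≡-Reasoning
  c : ℕ
  c = offset n st
  y : Fin (suc n)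
  y = (toℕ x + i * c) mod suc n
  coordinate : (toℕ y + j * c) % suc n ≡ (toℕ x + (i + j) * c) % suc n
  coordinate = begin
    (toℕ y + j * c) % suc n                ≡⟨ %-+-cong (toℕ y) (toℕ x + i * c) (j * c) (j * c) y≡x+ic refl ⟩
    (toℕ x + i * c + j * c) % suc n        ≡⟨ cong (_% suc n) (+-assoc (toℕ x) (i * c) (j * c)) ⟩
    (toℕ x + (i * c + j * c)) % suc n      ≡⟨ cong (λ t → (toℕ x + t) % suc n) (*-distribʳ-+ c i j) ⟨
    (toℕ x + (i + j) * c) % suc n          ∎
    where
    y≡x+ic : toℕ y % suc n ≡ (toℕ x + i * c) % suc n
    y≡x+ic = trans (cong (_% suc n) (toℕ-mod n (toℕ x + i * c))) (m%n%n≡m%n (toℕ x + i * c) (suc n))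

sumPos : ∀ {d} (s : Shape d) → (Pos s → ℕ) → ℕ
sumPos s f = sum (map f (allPos s))

sumPos-cons : ∀ {d} n (s : Shape d) (f : Pos (n ∷ s) → ℕ) →
  sumPos (n ∷ s) f ≡ sum (map (λ x → sumPos s (λ p → f (x , p))) (allFin (suc n)))
sumPos-cons n s f = begin
  sum (map f (concatMap (λ x → map (x ,_) (allPos s)) (allFin (suc n))))
    ≡⟨ cong sum (map-concatMap f (λ x → map (x ,_) (allPos s)) (allFin (suc n))) ⟩
  sum (concatMap (λ x → map f (map (x ,_) (allPos s))) (allFin (suc n)))
    ≡⟨ sum-concatMap (λ x → map f (map (x ,_) (allPos s))) (allFin (suc n)) ⟩
  sum (map (λ x → sum (map f (map (x ,_) (allPos s)))) (allFin (suc n)))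
    ≡⟨ sum-map-cong (λ x → cong sum (map-∘ (allPos s))) (allFin (suc n)) ⟨
  sum (map (λ x → sumPos s (λ p → f (x , p))) (allFin (suc n))) ∎
  where open ≡-Reasoning

sumPos-const : ∀ {d} (s : Shape d) c → sumPos s (const c) ≡ size s * c
sumPos-const []      c = refl
sumPos-const (n ∷ s) c = begin
  sumPos (n ∷ s) (const c)                                 ≡⟨ sumPos-cons n s (const c) ⟩
  sum (map (λ _ → sumPos s (const c)) (allFin (suc n)))    ≡⟨ sum-map-cong (λ _ → sumPos-const s c) (allFin (suc n)) ⟩
  sum (map (const (size s * c)) (allFin (suc n)))          ≡⟨ sum-map-const _ (allFin (suc n)) ⟩
  length (allFin (suc n)) * (size s * c)                   ≡⟨ cong (_* (size s * c)) (length-tabulate {n = suc n} (λ x → x)) ⟩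
  suc n * (size s * c)                                     ≡⟨ *-assoc (suc n) (size s) c ⟨
  size (n ∷ s) * c                                         ∎
  where open ≡-Reasoning

sumPos-shift : ∀ {d} (s : Shape d) v i (f : Pos s → ℕ) → sumPos s (λ p → f (shift s p v i)) ≡ sumPos s f
sumPos-shift []      []       i f = refl
sumPos-shift (n ∷ s) (st ∷ v) i f = begin
  sumPos (n ∷ s) (λ p → f (shift (n ∷ s) p (st ∷ v) i))
    ≡⟨ sumPos-cons n s _ ⟩
  sum (map (λ x → sumPos s (λ p → f (shift (n ∷ s) (x , p) (st ∷ v) i))) (allFin (suc n)))
    ≡⟨ sum-map-cong (λ x → sum-map-cong (λ p → cong f (shift-cons n s x p st v i)) (allPos s)) (allFin (suc n)) ⟩
  sum (map (λ x → sumPos s (λ p → f (move x , shift s p v i))) (allFin (suc n)))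
    ≡⟨ sum-map-cong (λ x → sumPos-shift s v i (λ p → f (move x , p))) (allFin (suc n)) ⟩
  sum (map (λ x → sumPos s (λ p → f (move x , p))) (allFin (suc n)))
    ≡⟨ sum-allFin-rotate n (λ y → sumPos s (λ p → f (y , p))) (i * offset n st) ⟩
  sum (map (λ x → sumPos s (λ p → f (x , p))) (allFin (suc n)))
    ≡⟨ sumPos-cons n s f ⟨
  sumPos (n ∷ s) f ∎
  where
  open ≡-Reasoning
  move : Fin (suc n) → Fin (suc n)
  move x = (toℕ x + i * offset n st) mod suc n

sumPos-section : ∀ {d} n (s : Shape d) (f : Pos (n ∷ s) → ℕ) (σ : Pos s → Fin (suc n)) →
  sumPos s (λ p → f (σ p , p)) ≤ sumPos (n ∷ s) f
sumPos-section n s f σ = begin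
  sumPos s (λ p → f (σ p , p))
    ≤⟨ sum-map-mono (λ p → ∈⇒≤-sum-map (λ x → f (x , p)) (∈-allFin (σ p))) (allPos s) ⟩
  sumPos s (λ p → sum (map (λ x → f (x , p)) (allFin (suc n))))
    ≡⟨ sum-map-comm (λ x p → f (x , p)) (allFin (suc n)) (allPos s) ⟨
  sum (map (λ x → sumPos s (λ p → f (x , p))) (allFin (suc n)))
    ≡⟨ sumPos-cons n s f ⟨
  sumPos (n ∷ s) f ∎
  where open ≤-Reasoning

module _ {Σ' : Set} (_≟_ : DecidableEquality Σ') where

  appearancesAlong : ∀ {d} {s : Shape d} → Grid Σ' s → List Σ' → Dir d → ℕ
  appearancesAlong {s = s} Γ w v = sumPos s (λ p → 𝟙 (appearsAt _≟_ Γ w p v))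

  appearances-sumPos : ∀ {d} {s : Shape d} (Γ : Grid Σ' s) w →
    appearances _≟_ Γ w ≡ sumPos s (λ p → sum (map (λ v → 𝟙 (appearsAt _≟_ Γ w p v)) (nonzeroDirs d)))
  appearances-sumPos {d} {s} Γ w = sum-concatMap (λ p → map (λ v → 𝟙 (appearsAt _≟_ Γ w p v)) (nonzeroDirs d)) (allPos s)

  appearances-sumAlong : ∀ {d} {s : Shape d} (Γ : Grid Σ' s) w →
    appearances _≟_ Γ w ≡ sum (map (appearancesAlong Γ w) (nonzeroDirs d))
  appearances-sumAlong {d} {s} Γ w =
    trans (appearances-sumPos Γ w) (sum-map-comm (λ p v → 𝟙 (appearsAt _≟_ Γ w p v)) (allPos s) (nonzeroDirs d))

  module _ {d} {s : Shape d} (Γ : Grid Σ' s) (p : Pos s) (v : Dir d) where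

    -- appearsAt scans the word with a local function that Defs does not export;
    -- matcher is that function, solved by unification against appearsAt-∷.
    mutual
      matcher : List Σ' → ℕ → List Σ' → Bool
      matcher = _

      appearsAt-∷ : ∀ a as → appearsAt _≟_ Γ (a ∷ as) p v ≡ (does (Γ (shift s p v 0) ≟ a) ∧ matcher (a ∷ as) 1 as)
      appearsAt-∷ a as with a ∷ as | 1
      ... | _ | _ = refl

    matcher-replicate⁺ : ∀ W i L b → T (matcher W i (replicate L b)) → ∀ k → k < L → Γ (shift s p v (i + k)) ≡ b
    matcher-replicate⁺ W i (suc L) b match zero    _ =
      subst (λ j → Γ (shift s p v j) ≡ b) (sym (+-identityʳ i))
        (Equivalence.to (T-does (_ ≟ b)) (proj₁ (Equivalence.to T-∧ match)))
    matcher-replicate⁺ W i (suc L) b match (suc k) k<L =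
      subst (λ j → Γ (shift s p v j) ≡ b) (sym (+-suc i k))
        (matcher-replicate⁺ W (suc i) L b (proj₂ (Equivalence.to T-∧ match)) k (s≤s⁻¹ k<L))

    matcher-replicate⁻ : ∀ W i L b → (∀ k → k < L → Γ (shift s p v (i + k)) ≡ b) → T (matcher W i (replicate L b))
    matcher-replicate⁻ W i zero    b all-b = tt
    matcher-replicate⁻ W i (suc L) b all-b = Equivalence.from T-∧
      ( Equivalence.from (T-does (_ ≟ b)) (subst (λ j → Γ (shift s p v j) ≡ b) (+-identityʳ i) (all-b 0 z<s))
      , matcher-replicate⁻ W (suc i) L b (λ k k<L → subst (λ j → Γ (shift s p v j) ≡ b) (+-suc i k) (all-b (suc k) (s<s k<L))))

coprime-∣ : ∀ {m n o} → Coprime m n → o ∣ n → Coprime m o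
coprime-∣ coprime o∣n (i∣m , i∣o) = coprime (i∣m , ∣-trans i∣o o∣n)

coprime-1 : ∀ {n} → Coprime n 1
coprime-1 (_ , i∣1) = ∣1⇒≡1 i∣1

coprime-+-* : ∀ {n u c} k → Coprime n u → c ≡ k * n + u → Coprime n c
coprime-+-* k coprime c≡kn+u {i} (i∣n , i∣c) =
  coprime (i∣n , ∣m+n∣m⇒∣n (subst (i ∣_) c≡kn+u i∣c) (∣n⇒∣m*n k i∣n))

coprime-complement : ∀ {n u c} k → Coprime n u → c + u ≡ k * n → Coprime n c
coprime-complement k coprime c+u≡kn {i} (i∣n , i∣c) =
  coprime (i∣n , ∣m+n∣m⇒∣n (subst (i ∣_) (sym c+u≡kn) (∣n⇒∣m*n k i∣n)) i∣c)

coprime-%≡0⇒∣ : ∀ {n c m} .{{_ : NonZero n}} → Coprime n c → (m * c) % n ≡ 0 → n ∣ m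
coprime-%≡0⇒∣ {n} {c} {m} coprime mc%n≡0 =
  coprime-divisor coprime (subst (n ∣_) (*-comm m c) (m%n≡0⇒n∣m (m * c) n mc%n≡0))

fraction-≤ : ∀ a s b t .{{_ : NonZero s}} .{{_ : NonZero t}} → a * t ≤ b * s → ℤ.+ a / s ℚ.≤ ℤ.+ b / t
fraction-≤ a (suc S) b (suc T) at≤bs = ℚ.toℚᵘ-cancel-≤
  (ℚᵘ.≤-respˡ-≃ (ℚᵘ.≃-sym (ℚ.toℚᵘ-fromℚᵘ (ℚᵘ.mkℚᵘ (ℤ.+ a) S)))
    (ℚᵘ.≤-respʳ-≃ (ℚᵘ.≃-sym (ℚ.toℚᵘ-fromℚᵘ (ℚᵘ.mkℚᵘ (ℤ.+ b) T)))
    (ℚᵘ.*≤* (subst₂ ℤ._≤_ (ℤ.pos-* a (suc T)) (ℤ.pos-* b (suc S)) (ℤ.+≤+ at≤bs)))))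

*-/ : ∀ m n t .{{_ : NonZero t}} → (ℤ.+ m / 1) ℚ.* (ℤ.+ n / t) ≡ ℤ.+ (m * n) / t
*-/ m n (suc T) = ℚ.toℚᵘ-injective (begin
  ℚ.toℚᵘ ((ℤ.+ m / 1) ℚ.* (ℤ.+ n / suc T))
    ≈⟨ ℚ.toℚᵘ-homo-* (ℤ.+ m / 1) (ℤ.+ n / suc T) ⟩
  ℚ.toℚᵘ (ℤ.+ m / 1) ℚᵘ.* ℚ.toℚᵘ (ℤ.+ n / suc T)
    ≈⟨ ℚᵘ.*-cong (ℚ.toℚᵘ-fromℚᵘ (ℚᵘ.mkℚᵘ (ℤ.+ m) 0)) (ℚ.toℚᵘ-fromℚᵘ (ℚᵘ.mkℚᵘ (ℤ.+ n) T)) ⟩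
  ℚᵘ.mkℚᵘ (ℤ.+ m) 0 ℚᵘ.* ℚᵘ.mkℚᵘ (ℤ.+ n) T
    ≈⟨ ℚᵘ.*≡* (cong₂ ℤ._*_ (sym (ℤ.pos-* m n)) (cong ℤ.+_ (sym (*-identityˡ (suc T))))) ⟩
  ℚᵘ.mkℚᵘ (ℤ.+ (m * n)) T
    ≈⟨ ℚ.toℚᵘ-fromℚᵘ (ℚᵘ.mkℚᵘ (ℤ.+ (m * n)) T) ⟨
  ℚ.toℚᵘ (ℤ.+ (m * n) / suc T) ∎)
  where open ℚᵘ.≃-Reasoning

≤⇒≤+positive : ∀ {p q} ε .{{_ : Positive ε}} → p ℚ.≤ q → p ℚ.≤ q ℚ.+ ε
≤⇒≤+positive {q = q} ε p≤q = ℚ.≤-trans p≤q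
  (subst (ℚ._≤ q ℚ.+ ε) (ℚ.+-identityʳ q) (ℚ.+-monoʳ-≤ q (ℚ.<⇒≤ (ℚ.positive⁻¹ ε))))

SupLe-intro : ∀ {P Q : ℚ → Set} b → Q b → (∀ a → P a → a ℚ.≤ b) → SupLe P Q
SupLe-intro b Qb bound a Pa ε ε>0 = b , Qb , ≤⇒≤+positive ε {{ε>0}} (bound a Pa)

module _ {Σ' : Set} (_≟_ : DecidableEquality Σ') {d} {s : Shape d} (Γ : Grid Σ' s) (w : List Σ')
         (K n : ℕ) .{{n≢0 : NonZero n}} where

  concentration-≤ : n * appearances _≟_ Γ w ≤ K * size s → concentration _≟_ Γ w ℚ.≤ ℤ.+ K / n
  concentration-≤ bound = fraction-≤ (appearances _≟_ Γ w) (size s) K n {{size-nonZero s}}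
    (subst (_≤ K * size s) (*-comm n (appearances _≟_ Γ w)) bound)

  concentration-≥ : K * size s ≤ n * appearances _≟_ Γ w → ℤ.+ K / n ℚ.≤ concentration _≟_ Γ w
  concentration-≥ bound = fraction-≤ K n (appearances _≟_ Γ w) (size s) {{n≢0}} {{size-nonZero s}}
    (subst (K * size s ≤_) (*-comm n (appearances _≟_ Γ w)) bound)

module ABᴸ {Σ' : Set} (_≟_ : DecidableEquality Σ') (A B : Σ') (L : ℕ) where

  ℓ : ℕ
  ℓ = suc L

  w : List Σ'
  w = A ∷ replicate L B

  Occurrence : ∀ {d} {s : Shape d} → Grid Σ' s → Pos s → Dir d → Set
  Occurrence {s = s} Γ p v = Γ (shift s p v 0) ≡ A × (∀ k → k < L → Γ (shift s p v (suc k)) ≡ B)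

  appearsAt⇔Occurrence : ∀ {d} {s : Shape d} (Γ : Grid Σ' s) p v → T (appearsAt _≟_ Γ w p v) ⇔ Occurrence Γ p v
  appearsAt⇔Occurrence Γ p v rewrite appearsAt-∷ _≟_ Γ p v A (replicate L B) = mk⇔
    (λ match → let startA , restB = Equivalence.to T-∧ match in
      Equivalence.to (T-does (_ ≟ A)) startA , matcher-replicate⁺ _≟_ Γ p v w 1 L B restB)
    (λ (startA , restB) → Equivalence.from T-∧
      (Equivalence.from (T-does (_ ≟ A)) startA , matcher-replicate⁻ _≟_ Γ p v w 1 L B restB))

  module _ (A≢B : A ≢ B) where

    occurrences-apart : ∀ {d} {s : Shape d} (Γ : Grid Σ' s) q v {i j} → i < j → j < ℓ →
      Occurrence Γ (shift s q v i) v → ¬ Occurrence Γ (shift s q v j) v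
    occurrences-apart {s = s} Γ q v {i} i<j j<ℓ (_ , restB) (startA , _)
      with k , refl ← m≤n⇒∃[o]m+o≡n i<j = A≢B (begin
        A                                        ≡⟨ startA ⟨
        Γ (shift s (shift s q v (suc i + k)) v 0) ≡⟨ cong Γ (shift-shift s q v (suc i + k) 0) ⟩
        Γ (shift s q v (suc i + k + 0))          ≡⟨ cong (Γ ∘ shift s q v) (trans (+-identityʳ _) (sym (+-suc i k))) ⟩
        Γ (shift s q v (i + suc k))              ≡⟨ cong Γ (shift-shift s q v i (suc k)) ⟨
        Γ (shift s (shift s q v i) v (suc k))    ≡⟨ restB k (≤-trans (s≤s (m≤n+m k i)) (s≤s⁻¹ j<ℓ)) ⟩
        B                                        ∎)
      where open ≡-Reasoning

    appearancesAlong-bound : ∀ {d} {s : Shape d} (Γ : Grid Σ' s) v → ℓ * appearancesAlong _≟_ Γ w v ≤ size s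
    appearancesAlong-bound {s = s} Γ v = begin
      ℓ * appearancesAlong _≟_ Γ w v
        ≡⟨ sum-applyUpTo-const _ ℓ ⟨
      sum (applyUpTo (λ _ → sumPos s occurs) ℓ)
        ≡⟨ sum-applyUpTo-cong (λ i → sumPos-shift s v i occurs) ℓ ⟨
      sum (applyUpTo (λ i → sumPos s (λ q → occurs (shift s q v i))) ℓ)
        ≡⟨ sum-applyUpTo-comm (λ i q → occurs (shift s q v i)) ℓ (allPos s) ⟩
      sumPos s (λ q → sum (applyUpTo (λ i → occurs (shift s q v i)) ℓ))
        ≤⟨ sum-map-mono (λ q → sum-applyUpTo-𝟙≤1 ℓ _ (λ i<j j<ℓ occ-i occ-j →
             occurrences-apart Γ q v i<j j<ℓ (to occ-i) (to occ-j))) (allPos s) ⟩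
      sumPos s (const 1)
        ≡⟨ sumPos-const s 1 ⟩
      size s * 1
        ≡⟨ *-identityʳ (size s) ⟩
      size s ∎
      where
      open ≤-Reasoning
      occurs : Pos s → ℕ
      occurs p = 𝟙 (appearsAt _≟_ Γ w p v)
      to : ∀ {p} → T (appearsAt _≟_ Γ w p v) → Occurrence Γ p v
      to = Equivalence.to (appearsAt⇔Occurrence Γ _ v)

    appearances-bound : ∀ {d} {s : Shape d} (Γ : Grid Σ' s) → ℓ * appearances _≟_ Γ w ≤ length (nonzeroDirs d) * size s
    appearances-bound {d} {s} Γ = begin
      ℓ * appearances _≟_ Γ w                                     ≡⟨ cong (ℓ *_) (appearances-sumAlong _≟_ Γ w) ⟩
      ℓ * sum (map (appearancesAlong _≟_ Γ w) (nonzeroDirs d))    ≡⟨ *-sum-map ℓ _ (nonzeroDirs d) ⟩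
      sum (map (λ v → ℓ * appearancesAlong _≟_ Γ w v) (nonzeroDirs d))
        ≤⟨ sum-map-mono (appearancesAlong-bound Γ) (nonzeroDirs d) ⟩
      sum (map (const (size s)) (nonzeroDirs d))                  ≡⟨ sum-map-const (size s) (nonzeroDirs d) ⟩
      length (nonzeroDirs d) * size s                             ∎
      where open ≤-Reasoning

    concentration-bound : ∀ {d} {s : Shape d} (Γ : Grid Σ' s) →
      concentration _≟_ Γ w ℚ.≤ ℤ.+ length (nonzeroDirs d) / ℓ
    concentration-bound {d} Γ = concentration-≤ _≟_ Γ w (length (nonzeroDirs d)) ℓ (appearances-bound Γ)

  cube : ∀ d → Shape d
  cube d = Vec.replicate d L

  form : ∀ {d} → Vec ℕ d → Pos (cube d) → ℕ
  form []      tt      = 0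
  form (a ∷ c) (x , p) = a * toℕ x + form c p

  weight : ∀ {d} → Vec ℕ d → Dir d → ℕ
  weight []      []       = 0
  weight (a ∷ c) (st ∷ v) = a * offset L st + weight c v

  form-shift : ∀ {d} (c : Vec ℕ d) p v k → form c (shift (cube d) p v k) % ℓ ≡ (form c p + k * weight c v) % ℓ
  form-shift []      tt      []       k = cong (_% ℓ) (sym (*-zeroʳ k))
  form-shift (a ∷ c) (x , p) (st ∷ v) k = begin
    form (a ∷ c) (shift (cube _) (x , p) (st ∷ v) k) % ℓ
      ≡⟨ cong (λ q → form (a ∷ c) q % ℓ) (shift-cons L (cube _) x p st v k) ⟩
    (a * toℕ y + form c (shift (cube _) p v k)) % ℓ
      ≡⟨ %-+-cong (a * toℕ y) (a * (toℕ x + k * o)) _ _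
           (%-*-congˡ a (toℕ y) (toℕ x + k * o) y≡x+ko) (form-shift c p v k) ⟩
    (a * (toℕ x + k * o) + (form c p + k * weight c v)) % ℓ
      ≡⟨ cong (_% ℓ) (regroup a (toℕ x) k o (form c p) (weight c v)) ⟩
    (form (a ∷ c) (x , p) + k * weight (a ∷ c) (st ∷ v)) % ℓ ∎
    where
    open ≡-Reasoning
    o : ℕ
    o = offset L st
    y : Fin ℓ
    y = (toℕ x + k * o) mod ℓ
    y≡x+ko : toℕ y % ℓ ≡ (toℕ x + k * o) % ℓ
    y≡x+ko = trans (cong (_% ℓ) (toℕ-mod L (toℕ x + k * o))) (m%n%n≡m%n (toℕ x + k * o) ℓ)
    regroup : ∀ a x k o f w → a * (x + k * o) + (f + k * w) ≡ a * x + f + k * (a * o + w)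
    regroup = solve-∀

  AorB : ℕ → Σ'
  AorB zero    = A
  AorB (suc _) = B

  linearGrid : ∀ {d} → Vec ℕ d → Grid Σ' (cube d)
  linearGrid c p = AorB (form c p % ℓ)

  linearGrid-occurrence : ∀ {d} (c : Vec ℕ d) p v → form c p % ℓ ≡ 0 → Coprime ℓ (weight c v) →
    Occurrence (linearGrid c) p v
  linearGrid-occurrence c p v p↦A coprime = cong AorB (form-after 0) , B-after
    where
    form-after : ∀ k → form c (shift (cube _) p v k) % ℓ ≡ (k * weight c v) % ℓ
    form-after k = trans (form-shift c p v k) (%-+-cong (form c p) 0 (k * weight c v) (k * weight c v) p↦A refl)
    B-after : ∀ k → k < L → linearGrid c (shift (cube _) p v (suc k)) ≡ B
    B-after k k<L with form c (shift (cube _) p v (suc k)) % ℓ in eq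
    ... | suc _ = refl
    ... | zero  = ⊥-elim (<⇒≱ (s≤s k<L) (∣⇒≤ (coprime-%≡0⇒∣ coprime (trans (sym (form-after (suc k))) eq))))

  -- L ≡ −1 (mod ℓ), so the first coordinate cancels the rest of the form 1 ∷ c.
  A-position : ∀ {d} → Vec ℕ d → Pos (cube d) → Fin ℓ
  A-position c p = (L * form c p) mod ℓ

  form-A-position : ∀ {d} (c : Vec ℕ d) p → form (1 ∷ c) (A-position c p , p) % ℓ ≡ 0
  form-A-position c p = begin
    (1 * toℕ (A-position c p) + f) % ℓ
      ≡⟨ %-+-cong (1 * toℕ (A-position c p)) (1 * (L * f)) f f (%-*-congˡ 1 (toℕ (A-position c p)) (L * f) reduce) refl ⟩
    (1 * (L * f) + f) % ℓ                ≡⟨ cong (_% ℓ) (multiple L f) ⟩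
    (f * ℓ) % ℓ                          ≡⟨ m*n%n≡0 f ℓ ⟩
    0                                    ∎
    where
    open ≡-Reasoning
    f : ℕ
    f = form c p
    reduce : toℕ (A-position c p) % ℓ ≡ (L * f) % ℓ
    reduce = trans (cong (_% ℓ) (toℕ-mod L (L * f))) (m%n%n≡m%n (L * f) ℓ)
    multiple : ∀ L f → 1 * (L * f) + f ≡ f * suc L
    multiple = solve-∀

  linearGrid-appearances : ∀ {d} (c : Vec ℕ d) → All (Coprime ℓ ∘ weight (1 ∷ c)) (nonzeroDirs (suc d)) →
    length (nonzeroDirs (suc d)) * size (cube (suc d)) ≤ ℓ * appearances _≟_ (linearGrid (1 ∷ c)) w
  linearGrid-appearances {d} c coprime = begin
    K * (ℓ * size (cube d))  ≡⟨ x*[y*z]≡y*[z*x] K ℓ (size (cube d)) ⟩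
    ℓ * (size (cube d) * K)  ≤⟨ *-monoʳ-≤ ℓ A-positions-suffice ⟩
    ℓ * appearances _≟_ Γ w  ∎
    where
    open ≤-Reasoning
    K : ℕ
    K = length (nonzeroDirs (suc d))
    Γ : Grid Σ' (cube (suc d))
    Γ = linearGrid (1 ∷ c)
    appearancesAt : Pos (cube (suc d)) → ℕ
    appearancesAt p = sum (map (λ v → 𝟙 (appearsAt _≟_ Γ w p v)) (nonzeroDirs (suc d)))
    appearancesAt-A-position : ∀ q → appearancesAt (A-position c q , q) ≡ K
    appearancesAt-A-position q = sum-map-𝟙-all (appearsAt _≟_ Γ w (A-position c q , q)) (All.map
      (λ {v} → Equivalence.from (appearsAt⇔Occurrence Γ _ v) ∘ linearGrid-occurrence (1 ∷ c) _ v (form-A-position c q))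
      coprime)
    A-positions-suffice : size (cube d) * K ≤ appearances _≟_ Γ w
    A-positions-suffice = begin
      size (cube d) * K                                   ≡⟨ sumPos-const (cube d) K ⟨
      sumPos (cube d) (const K)                           ≡⟨ sum-map-cong appearancesAt-A-position (allPos (cube d)) ⟨
      sumPos (cube d) (λ q → appearancesAt (A-position c q , q)) ≤⟨ sumPos-section L (cube d) appearancesAt (A-position c) ⟩
      sumPos (cube (suc d)) appearancesAt                 ≡⟨ appearances-sumPos _≟_ Γ w ⟨
      appearances _≟_ Γ w                                 ∎
    x*[y*z]≡y*[z*x] : ∀ x y z → x * (y * z) ≡ y * (z * x)
    x*[y*z]≡y*[z*x] = solve-∀

  concentration-linearGrid : ∀ {d} (c : Vec ℕ d) → All (Coprime ℓ ∘ weight (1 ∷ c)) (nonzeroDirs (suc d)) →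
    ℤ.+ length (nonzeroDirs (suc d)) / ℓ ℚ.≤ concentration _≟_ (linearGrid (1 ∷ c)) w
  concentration-linearGrid {d} c coprime =
    concentration-≥ _≟_ (linearGrid (1 ∷ c)) w (length (nonzeroDirs (suc d))) ℓ (linearGrid-appearances c coprime)

  weights₁-coprime : All (Coprime ℓ ∘ weight (1 ∷ [])) (nonzeroDirs 1)
  weights₁-coprime = coprime-complement 1 coprime-1 (w[−1] L) ∷ coprime-1 ∷ []
    where
    w[−1] : ∀ L → 1 * L + 0 + 1 ≡ 1 * suc L
    w[−1] = solve-∀

  module _ (gcd[ℓ,6]≡1 : gcd ℓ 6 ≡ 1) where

    coprime-2 : Coprime ℓ 2
    coprime-2 = coprime-∣ (gcd≡1⇒coprime gcd[ℓ,6]≡1) (divides 3 refl)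

    coprime-3 : Coprime ℓ 3
    coprime-3 = coprime-∣ (gcd≡1⇒coprime gcd[ℓ,6]≡1) (divides 2 refl)

    weights₂-coprime : All (Coprime ℓ ∘ weight (1 ∷ 2 ∷ [])) (nonzeroDirs 2)
    -- Along the directions of nonzeroDirs 2, in order, x + 2y changes by −3, −1, 1, −2, 2, −1, 1, 3.
    weights₂-coprime =
      coprime-complement 3 coprime-3 (w[−1,−1] L) ∷
      coprime-complement 1 coprime-1 (w[−1,0] L) ∷
      coprime-+-* 1 coprime-1 (w[−1,1] L) ∷
      coprime-complement 2 coprime-2 (w[0,−1] L) ∷
      coprime-2 ∷
      coprime-complement 2 coprime-1 (w[1,−1] L) ∷
      coprime-1 ∷
      coprime-3 ∷ []
      where
      w[−1,−1] : ∀ L → 1 * L + (2 * L + 0) + 3 ≡ 3 * suc L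
      w[−1,−1] = solve-∀
      w[−1,0] : ∀ L → 1 * L + (2 * 0 + 0) + 1 ≡ 1 * suc L
      w[−1,0] = solve-∀
      w[−1,1] : ∀ L → 1 * L + (2 * 1 + 0) ≡ 1 * suc L + 1
      w[−1,1] = solve-∀
      w[0,−1] : ∀ L → 1 * 0 + (2 * L + 0) + 2 ≡ 2 * suc L
      w[0,−1] = solve-∀
      w[1,−1] : ∀ L → 1 * 1 + (2 * L + 0) + 1 ≡ 2 * suc L
      w[1,−1] = solve-∀

proposition8p1 : (Σ' : Set) (_≟_ : DecidableEquality Σ') (A B : Σ') → A ≢ B →
    (ℓ : ℕ) → 1 < ℓ → gcd ℓ 6 ≡ 1 →
    TwoSlantable _≟_ (A ∷ replicate (ℓ ∸ 1) B)
-- 1 < ℓ only rules out ℓ = 0; the argument also covers ℓ = 1.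
proposition8p1 Σ' _≟_ A B A≢B (suc L) _ gcd[ℓ,6]≡1 = C₂≤4C₁ , 4C₁≤C₂
  where
  open ABᴸ _≟_ A B L
  open ℚ.≤-Reasoning

  grid₁ : Grid Σ' (cube 1)
  grid₁ = linearGrid (1 ∷ [])

  grid₂ : Grid Σ' (cube 2)
  grid₂ = linearGrid (1 ∷ 2 ∷ [])

  C₂≤4C₁ : SupLe (Concentrations _≟_ 2 w) (Scale (ℤ.+ 4 / 1) (Concentrations _≟_ 1 w))
  C₂≤4C₁ = SupLe-intro _ (_ , (_ , grid₁ , refl) , refl) λ where
    _ (_ , Γ , refl) → begin
      concentration _≟_ Γ w                      ≤⟨ concentration-bound A≢B Γ ⟩
      ℤ.+ 8 / ℓ                                  ≡⟨ *-/ 4 2 ℓ ⟨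
      (ℤ.+ 4 / 1) ℚ.* (ℤ.+ 2 / ℓ)
        ≤⟨ ℚ.*-monoˡ-≤-nonNeg (ℤ.+ 4 / 1) (concentration-linearGrid [] weights₁-coprime) ⟩
      (ℤ.+ 4 / 1) ℚ.* concentration _≟_ grid₁ w  ∎

  4C₁≤C₂ : SupLe (Scale (ℤ.+ 4 / 1) (Concentrations _≟_ 1 w)) (Concentrations _≟_ 2 w)
  4C₁≤C₂ = SupLe-intro _ (_ , grid₂ , refl) λ where
    _ (_ , (_ , Γ , refl) , refl) → begin
      (ℤ.+ 4 / 1) ℚ.* concentration _≟_ Γ w      ≤⟨ ℚ.*-monoˡ-≤-nonNeg (ℤ.+ 4 / 1) (concentration-bound A≢B Γ) ⟩
      (ℤ.+ 4 / 1) ℚ.* (ℤ.+ 2 / ℓ)                ≡⟨ *-/ 4 2 ℓ ⟩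
      ℤ.+ 8 / ℓ                                  ≤⟨ concentration-linearGrid (2 ∷ []) (weights₂-coprime gcd[ℓ,6]≡1) ⟩
      concentration _≟_ grid₂ w                  ∎
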